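{- Let $U=(V,E)$ be an undirected graph with $V=\{x_1,\ldots,x_n\}$ whose edges are colored by $c:E\to\{0,1,\ldots,n^2-1\}$; write $e_{ij}$ for the edge $\{x_i,x_j\}$. Construct a PDS $\mathcal{P}$ with stack alphabet $\{0,1\}$ and ordinary states $x_i,y_i,z_i,x'_i,y'_i$ ($i=1,\ldots,n$) (the states $x_i$ of $\mathcal{P}$ are identified by name with the vertices of $U$), with the following macro-transitions, for every ordered pair $(i,j)$ with $e_{ij}\in E$: (1) from state $x_i$ push $[i]_2$, then $[j]_2$, then $[c(e_{ij})]_2'$, and go to $y_j$; (2) from state $y_i$ pop $[c(e_{ij})]_2'$, then push $[c(e_{ij})]_2'$ again, and go to $z_j$; (3) from state $z_i$ pop $[c(e_{ij})]_2'$ and go to $x'_j$; (4) from state $x'_i$ pop $[j]_2$ and then pop $[i]_2$, and go to $y'_j$. Here "pop the word $u$" means popping $|u|$ symbols, which succeeds exactly when the top of the stack consists of the symbols of $u$ as they were pushed (so they are read in reverse order); every macro-transition is realized by a chain of single-symbol push or pop transitions through fresh auxiliary states. Then for every edge $e_{ij}\in E$, there is a monochromatic triangle in $U$ containing $e_{ij}$ (a vertex $x_k$ with $e_{jk},e_{ki}\in E$ and $c(e_{ij})=c(e_{jk})=c(e_{ki})$) if and only if $y'_j$ is reachable from $x_i$ in $\mathcal{P}$, i.e. there is a path from $(x_i,\epsilon)$ to $(y'_j,\epsilon)$ in the configuration graph of $\mathcal{P}$.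
   Context: $[i]_2$ denotes the binary representation of $i$ padded with leading zeros to length $\lceil\log n\rceil$, and $[c]_2'$ denotes the binary representation of a color $c$ padded to length $2\lceil\log n\rceil$. A push-down system (PDS) is $\mathcal{P}=(Q,\Gamma,\delta)$, $\delta\subseteq Q\times(\Gamma\cup\{\epsilon\})\times Q\times\Gamma^*$; configurations are pairs $(q,w)\in Q\times\Gamma^*$ (leftmost symbol on top), and the configuration graph has an edge $(q_1,w_1)\to(q_2,w_2)$ when $(q_1,\gamma,q_2,w)\in\delta$ and either $w_1=\gamma=\epsilon$, $w_2=w$, or $\gamma\ne\epsilon$, $w_1=\gamma w'$, $w_2=ww'$. Pushing a symbol $g$ is a transition $(p,\epsilon,q,g)$; popping $g$ is a transition $(p,g,q,\epsilon)$. -}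

module Defs where

open import Level using (0ℓ)
open import Data.Bool using (Bool; true; false; if_then_else_)
open import Data.Nat using (ℕ; zero; suc; _+_; _*_; _≡ᵇ_)
open import Data.Nat.DivMod using (_/_; _%_)
open import Data.Nat.Logarithm using (⌈log₂_⌉)
open import Data.Fin using (Fin; toℕ)
open import Data.List using (List; []; _∷_; _++_; map; reverse)
open import Data.List.Membership.Propositional using (_∈_)
open import Data.Maybe using (Maybe; just; nothing)
open import Data.Product using (_×_; _,_; Σ; ∃)
open import Relation.Binary.PropositionalEquality using (_≡_)
open import Relation.Binary.Construct.Closure.ReflexiveTransitive using (Star)

record PDS : Set₁ where
  field
    Q : Set
    Γ : Set
    -- δ p γ q w : transition (p, γ, q, w); γ = nothing encodes ε
    δ : Q → Maybe Γ → Q → List Γ → Set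

module _ (P : PDS) where
  open PDS P

  Config : Set
  Config = Q × List Γ

  -- edge of the configuration graph (leftmost symbol = top of stack)
  data Step : Config → Config → Set where
    stepε   : ∀ {q₁ q₂ w w'} → δ q₁ nothing q₂ w → Step (q₁ , w') (q₂ , w ++ w')
    stepPop : ∀ {q₁ q₂ g w w'} → δ q₁ (just g) q₂ w → Step (q₁ , g ∷ w') (q₂ , w ++ w')

  Reach : Config → Config → Set
  Reach = Star Step

-- Binary encodings (big-endian, padded / truncated to a given length)

bin : ℕ → ℕ → List Bool
bin zero    v = []
bin (suc l) v = bin l (v / 2) ++ ((if v % 2 ≡ᵇ 0 then false else true) ∷ [])

-- Edge-coloured undirected (simple) graphs on vertices Fin n
-- (vertex x_{i+1} of the paper is  i : Fin n)

record ColouredGraph (n : ℕ) : Set where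
  field
    adj       : Fin n → Fin n → Bool
    adj-sym   : ∀ i j → adj i j ≡ adj j i
    adj-irr   : ∀ i → adj i i ≡ false
    col       : Fin n → Fin n → Fin (n * n)
    col-sym   : ∀ i j → col i j ≡ col j i

  Edge : Fin n → Fin n → Set
  Edge i j = adj i j ≡ true

  MonoTriangle : Fin n → Fin n → Set
  MonoTriangle i j = ∃ λ k → Edge j k × Edge k i
                           × col i j ≡ col j k × col j k ≡ col k i

data Kind : Set where
  k1 k2 k3 k4 : Kind

data State (n : ℕ) : Set where
  x y z x' y' : Fin n → State n
  -- fresh auxiliary states: one family per macro-transition (kind, i, j)
  aux : Kind → Fin n → Fin n → ℕ → State n

data Op : Set where
  push pop : Bool → Op

Trans : ℕ → Set
Trans n = State n × Maybe Bool × State n × List Bool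

opT : ∀ {n} → State n → Op → State n → Trans n
opT p (push g) q = p , nothing , q , g ∷ []
opT p (pop g)  q = p , just g  , q , []

-- realise a sequence of single-symbol operations as a chain of transitions
-- src → a 0 → a 1 → … → tgt through auxiliary states a
-- (an empty sequence is a single ε-move; it never occurs for simple graphs with an edge)
chain : ∀ {n} → State n → (ℕ → State n) → State n → List Op → List (Trans n)
chain s a t []             = (s , nothing , t , []) ∷ []
chain s a t (o ∷ [])       = opT s o t ∷ []
chain s a t (o ∷ o' ∷ os)  = opT s o (a 0) ∷ chain (a 0) (λ m → a (suc m)) t (o' ∷ os)

pushW : List Bool → List Op
pushW u = map push u

-- pop the word u: succeeds iff the top of the stack is u as it was pushed
popW : List Bool → List Op
popW u = map pop (reverse u)

module Construction {n : ℕ} (G : ColouredGraph n) where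
  open ColouredGraph G

  L : ℕ
  L = ⌈log₂ n ⌉

  vtx : Fin n → List Bool
  vtx i = bin L (toℕ i)

  clr : Fin n → Fin n → List Bool
  clr i j = bin (2 * L) (toℕ (col i j))

  macroT : Kind → Fin n → Fin n → List (Trans n)
  macroT k1 i j = chain (x i)  (aux k1 i j) (y j)
                       (pushW (vtx i) ++ pushW (vtx j) ++ pushW (clr i j))
  macroT k2 i j = chain (y i)  (aux k2 i j) (z j)
                       (popW (clr i j) ++ pushW (clr i j))
  macroT k3 i j = chain (z i)  (aux k3 i j) (x' j) (popW (clr i j))
  macroT k4 i j = chain (x' i) (aux k4 i j) (y' j) (popW (vtx j) ++ popW (vtx i))

  data δ : State n → Maybe Bool → State n → List Bool → Set where
    mac : ∀ {i j p g q w} (k : Kind) → Edge i j →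
          (p , g , q , w) ∈ macroT k i j → δ p g q w

  𝒫 : PDS
  𝒫 = record { Q = State n ; Γ = Bool ; δ = δ }

{-# OPTIONS --safe #-}
module Submission where

-- A triangle x_i, x_j, x_k gives the run x_i → y_j → z_k → x'_i → y'_j: the pop in macro (2)
-- matches the colour pushed by (1) because c(e_ij) = c(e_jk), the pop in (3) because
-- c(e_jk) = c(e_ki), and (4) then pops [j]_2 [i]_2. Conversely, the stack at a main state
-- reachable from (x_i, ε) records the path so far, and since the encodings have fixed length
-- and are injective, every successful pop identifies the popped vertex or colour. So every
-- macro preserves this invariant, and at y'_j it yields the triangle. Intermediate chain states
-- are handled by remembering the partial run of their macro.

open import Defs
open import Data.Bool using (Bool; true; false; if_then_else_)
open import Data.Empty using (⊥)
open import Data.Fin using (Fin; toℕ)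
open import Data.Fin.Properties using (toℕ<n; toℕ-injective)
open import Data.List using (List; []; _∷_; _++_; _ʳ++_; [_]; map; reverse; length)
open import Data.List.Membership.Propositional using (_∈_)
open import Data.List.Properties
  using ( ∷-injective; ∷ʳ-injective; ++-assoc; ++-identityʳ; length-++; length-reverse; ʳ++-defn
        ; reverse-injective)
open import Data.List.Relation.Unary.Any using (here; there)
open import Data.Maybe using (Maybe; nothing)
open import Data.Nat
open import Data.Nat.DivMod using (_/_; _%_; m≡m%n+[m/n]*n; m%n<n; m<n*o⇒m/o<n)
open import Data.Nat.Induction using (<-wellFounded)
open import Data.Nat.Logarithm using (⌈log₂_⌉)
open import Data.Nat.Logarithm.Core using (⌈log2⌉)
open import Data.Nat.Properties
open import Data.Product using (∃; ∃₂; _×_; _,_; proj₁; proj₂)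
open import Data.Sum using (_⊎_; inj₁; inj₂)
open import Function.Bundles using (_⇔_; mk⇔)
open import Induction.WellFounded using (Acc; acc)
open import Relation.Binary.Construct.Closure.ReflexiveTransitive using (ε; _◅_; _◅◅_)
open import Relation.Binary.PropositionalEquality
  using (_≡_; refl; sym; trans; cong; cong₂; subst; module ≡-Reasoning)

n≤⌈n/2⌉+⌈n/2⌉ : ∀ n → n ≤ ⌈ n /2⌉ + ⌈ n /2⌉
n≤⌈n/2⌉+⌈n/2⌉ n = subst (_≤ ⌈ n /2⌉ + ⌈ n /2⌉) (⌊n/2⌋+⌈n/2⌉≡n n) (+-monoˡ-≤ ⌈ n /2⌉ (⌊n/2⌋≤⌈n/2⌉ n))

2+n≤2*[1+⌈n/2⌉] : ∀ n {m} → suc ⌈ n /2⌉ ≤ m → suc (suc n) ≤ 2 * m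
2+n≤2*[1+⌈n/2⌉] n {m} 1+h≤m = begin
  suc (suc n)        ≤⟨ s≤s (s≤s (n≤⌈n/2⌉+⌈n/2⌉ n)) ⟩
  suc (suc (h + h))  ≡⟨ cong suc (+-suc h h) ⟨
  suc h + suc h      ≤⟨ +-mono-≤ 1+h≤m 1+h≤m ⟩
  m + m              ≡⟨ cong (m +_) (+-identityʳ m) ⟨
  2 * m              ∎
  where
  open ≤-Reasoning
  h = ⌈ n /2⌉

n≤2^⌈log2⌉ : ∀ n (rec : Acc _<_ n) → n ≤ 2 ^ ⌈log2⌉ n rec
n≤2^⌈log2⌉ zero          _        = z≤n
n≤2^⌈log2⌉ (suc zero)    _        = s≤s z≤n
n≤2^⌈log2⌉ (suc (suc n)) (acc rs) =
  2+n≤2*[1+⌈n/2⌉] n (n≤2^⌈log2⌉ (suc ⌈ n /2⌉) (rs (⌈n/2⌉<n n)))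

n≤2^⌈log₂n⌉ : ∀ n → n ≤ 2 ^ ⌈log₂ n ⌉
n≤2^⌈log₂n⌉ n = n≤2^⌈log2⌉ n (<-wellFounded n)

length-bin : ∀ l v → length (bin l v) ≡ l
length-bin zero    v = refl
length-bin (suc l) v = begin
  length (bin (suc l) v)      ≡⟨ length-++ (bin l (v / 2)) ⟩
  length (bin l (v / 2)) + 1  ≡⟨ cong (_+ 1) (length-bin l (v / 2)) ⟩
  l + 1                       ≡⟨ +-comm l 1 ⟩
  suc l                       ∎
  where open ≡-Reasoning

bit-injective : ∀ {r s} → r < 2 → s < 2 →
                (if r ≡ᵇ 0 then false else true) ≡ (if s ≡ᵇ 0 then false else true) → r ≡ s
bit-injective {0}       {0}       _ _ _ = refl
bit-injective {1}       {1}       _ _ _ = refl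
bit-injective {0}       {1}       _ _ ()
bit-injective {1}       {0}       _ _ ()
bit-injective {suc (suc _)} (s≤s (s≤s ())) _ _
bit-injective {_} {suc (suc _)} _ (s≤s (s≤s ())) _

bin-injective : ∀ l {a b} → a < 2 ^ l → b < 2 ^ l → bin l a ≡ bin l b → a ≡ b
bin-injective zero    a<1 b<1 _ = trans (n<1⇒n≡0 a<1) (sym (n<1⇒n≡0 b<1))
bin-injective (suc l) {a} {b} a<2^1+l b<2^1+l eq = begin
  a                  ≡⟨ m≡m%n+[m/n]*n a 2 ⟩
  a % 2 + a / 2 * 2  ≡⟨ cong₂ (λ r q → r + q * 2) low high ⟩
  b % 2 + b / 2 * 2  ≡⟨ m≡m%n+[m/n]*n b 2 ⟨
  b                  ∎
  where
  open ≡-Reasoning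
  half< : ∀ {v} → v < 2 ^ suc l → v / 2 < 2 ^ l
  half< {v} v< = m<n*o⇒m/o<n (subst (v <_) (*-comm 2 (2 ^ l)) v<)
  high : a / 2 ≡ b / 2
  high = bin-injective l (half< a<2^1+l) (half< b<2^1+l) (proj₁ (∷ʳ-injective _ _ eq))
  low : a % 2 ≡ b % 2
  low = bit-injective (m%n<n a 2) (m%n<n b 2) (proj₂ (∷ʳ-injective _ _ eq))

bin-toℕ-injective : ∀ {m} l → m ≤ 2 ^ l → (a b : Fin m) → bin l (toℕ a) ≡ bin l (toℕ b) → a ≡ b
bin-toℕ-injective l m≤2^l a b eq =
  toℕ-injective (bin-injective l (<-≤-trans (toℕ<n a) m≤2^l) (<-≤-trans (toℕ<n b) m≤2^l) eq)

++-injective : ∀ {A : Set} (xs ys : List A) {zs ws : List A} →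
               length xs ≡ length ys → xs ++ zs ≡ ys ++ ws → xs ≡ ys × zs ≡ ws
++-injective []       []       _   eq = refl , eq
++-injective (_ ∷ xs) (_ ∷ ys) len eq with refl , eq′ ← ∷-injective eq
  with refl , refl ← ++-injective xs ys (suc-injective len) eq′ = refl , refl

reverse-++-injective : ∀ {A : Set} (u v : List A) {w w′ : List A} →
                       length u ≡ length v → reverse u ++ w ≡ reverse v ++ w′ → u ≡ v × w ≡ w′
reverse-++-injective u v len eq
  with u≡ , w≡ ← ++-injective (reverse u) (reverse v)
                   (trans (length-reverse u) (trans len (sym (length-reverse v)))) eq
  = reverse-injective u≡ , w≡

data Exec : Op → List Bool → List Bool → Set where
  push : ∀ {g w} → Exec (push g) w (g ∷ w)
  pop  : ∀ {g w} → Exec (pop g) (g ∷ w) w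

infixr 5 _∷_

data Run : List Op → List Bool → List Bool → Set where
  []  : ∀ {w} → Run [] w w
  _∷_ : ∀ {o os w w₁ w₂} → Exec o w w₁ → Run os w₁ w₂ → Run (o ∷ os) w w₂

Run-deterministic : ∀ {os w w₁ w₂} → Run os w w₁ → Run os w w₂ → w₁ ≡ w₂
Run-deterministic []         []         = refl
Run-deterministic (push ∷ r) (push ∷ s) = Run-deterministic r s
Run-deterministic (pop  ∷ r) (pop  ∷ s) = Run-deterministic r s

Run-++ : ∀ {xs ys u v w} → Run xs u v → Run ys v w → Run (xs ++ ys) u w
Run-++ []      s = s
Run-++ (e ∷ r) s = e ∷ Run-++ r s

Run-++⁻ : ∀ xs {ys u w} → Run (xs ++ ys) u w → ∃ λ v → Run xs u v × Run ys v w
Run-++⁻ []       r       = _ , [] , r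
Run-++⁻ (_ ∷ xs) (e ∷ r) with v , r₁ , r₂ ← Run-++⁻ xs r = v , e ∷ r₁ , r₂

Run-pushW : ∀ u {w} → Run (pushW u) w (reverse u ++ w)
Run-pushW u {w} = subst (Run (pushW u) w) (ʳ++-defn u) (pushes u)
  where
  pushes : ∀ u {w} → Run (map push u) w (u ʳ++ w)
  pushes []      = []
  pushes (g ∷ u) = push ∷ pushes u

Run-pops : ∀ v {w} → Run (map pop v) (v ++ w) w
Run-pops []      = []
Run-pops (g ∷ v) = pop ∷ Run-pops v

Run-pops⁻ : ∀ v {w w′} → Run (map pop v) w w′ → w ≡ v ++ w′
Run-pops⁻ []      []      = refl
Run-pops⁻ (g ∷ v) (pop ∷ r) = cong (g ∷_) (Run-pops⁻ v r)

module Chains {n : ℕ} (Δ : State n → Maybe Bool → State n → List Bool → Set) where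

  pds : PDS
  pds = record { Q = State n ; Γ = Bool ; δ = Δ }

  Admitted : Trans n → Set
  Admitted (p , g , q , u) = Δ p g q u

  Exec⇒Step : ∀ {p q o w w′} → Admitted (opT p o q) → Exec o w w′ → Step pds (p , w) (q , w′)
  Exec⇒Step d push = stepε d
  Exec⇒Step d pop  = stepPop d

  Run⇒Reach : ∀ {s A t ops w w′} → (∀ {tr} → tr ∈ chain s A t ops → Admitted tr) →
              Run ops w w′ → Reach pds (s , w) (t , w′)
  Run⇒Reach {ops = []}          admitted []      = stepε (admitted (here refl)) ◅ ε
  Run⇒Reach {ops = _ ∷ []}      admitted (e ∷ []) = Exec⇒Step (admitted (here refl)) e ◅ ε
  Run⇒Reach {ops = _ ∷ _ ∷ _}   admitted (e ∷ r) =
    Exec⇒Step (admitted (here refl)) e ◅ Run⇒Reach (λ m → admitted (there m)) r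

  -- the state of chain s A t after k operations, with the operations rest still to come
  stateAt : State n → (ℕ → State n) → State n → ℕ → List Op → State n
  stateAt s A t zero    _       = s
  stateAt s A t (suc k) []      = t
  stateAt s A t (suc k) (_ ∷ _) = A k

  ∈-chain⁻ : ∀ {s A t ops tr} → tr ∈ chain s A t ops →
             (ops ≡ [] × tr ≡ (s , nothing , t , [])) ⊎
             ∃ λ pre → ∃₂ λ o post → ops ≡ pre ++ o ∷ post ×
               tr ≡ opT (stateAt s A t (length pre) (o ∷ post)) o (stateAt s A t (suc (length pre)) post)
  ∈-chain⁻ {ops = []}         (here refl) = inj₁ (refl , refl)
  ∈-chain⁻ {ops = o ∷ []}     (here refl) = inj₂ ([] , o , [] , refl , refl)
  ∈-chain⁻ {ops = o ∷ o′ ∷ os} (here refl) = inj₂ ([] , o , o′ ∷ os , refl , refl)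
  ∈-chain⁻ {s} {A} {t} {ops = o ∷ _ ∷ _} (there m) with ∈-chain⁻ m
  ... | inj₂ (pre , o″ , post , eq , refl) =
    inj₂ (o ∷ pre , o″ , post , cong (o ∷_) eq ,
          cong₂ (λ p q → opT p o″ q) (shift-source pre) (shift-target post))
    where
    shift-source : ∀ pre → stateAt (A 0) (λ m → A (suc m)) t (length pre) (o″ ∷ post) ≡ A (length pre)
    shift-source []      = refl
    shift-source (_ ∷ _) = refl
    shift-target : ∀ post → stateAt (A 0) (λ m → A (suc m)) t (suc (length pre)) post
                          ≡ stateAt s A t (suc (suc (length pre))) post
    shift-target []      = refl
    shift-target (_ ∷ _) = refl

module Reduction {n : ℕ} (G : ColouredGraph n) where
  open ColouredGraph G
  open Construction G
  open Chains δ using (Admitted; Run⇒Reach; stateAt; ∈-chain⁻)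

  source : Kind → Fin n → State n
  source k1 a = x a
  source k2 a = y a
  source k3 a = z a
  source k4 a = x' a

  target : Kind → Fin n → State n
  target k1 b = y b
  target k2 b = z b
  target k3 b = x' b
  target k4 b = y' b

  ops : Kind → Fin n → Fin n → List Op
  ops k1 a b = pushW (vtx a) ++ pushW (vtx b) ++ pushW (clr a b)
  ops k2 a b = popW (clr a b) ++ pushW (clr a b)
  ops k3 a b = popW (clr a b)
  ops k4 a b = popW (vtx b) ++ popW (vtx a)

  macroT≡chain : ∀ κ a b → macroT κ a b ≡ chain (source κ a) (aux κ a b) (target κ b) (ops κ a b)
  macroT≡chain k1 a b = refl
  macroT≡chain k2 a b = refl
  macroT≡chain k3 a b = refl
  macroT≡chain k4 a b = refl

  Run⇒Reach-macroT : ∀ κ {a b w w′} → Edge a b → Run (ops κ a b) w w′ →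
                    Reach 𝒫 (source κ a , w) (target κ b , w′)
  Run⇒Reach-macroT κ {a} {b} e = Run⇒Reach λ m → mac κ e (subst (_ ∈_) (sym (macroT≡chain κ a b)) m)

  revVtx : Fin n → List Bool
  revVtx a = reverse (vtx a)

  revClr : Fin n → Fin n → List Bool
  revClr a b = reverse (clr a b)

  n*n≤2^[2*L] : n * n ≤ 2 ^ (2 * L)
  n*n≤2^[2*L] = begin
    n * n          ≤⟨ *-mono-≤ (n≤2^⌈log₂n⌉ n) (n≤2^⌈log₂n⌉ n) ⟩
    2 ^ L * 2 ^ L  ≡⟨ ^-distribˡ-+-* 2 L L ⟨
    2 ^ (L + L)    ≡⟨ cong (λ m → 2 ^ (L + m)) (+-identityʳ L) ⟨
    2 ^ (2 * L)    ∎
    where open ≤-Reasoning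

  revVtx-peel : ∀ {a b w w′} → revVtx a ++ w ≡ revVtx b ++ w′ → a ≡ b × w ≡ w′
  revVtx-peel {a} {b} eq
    with vtx≡ , w≡ ← reverse-++-injective (vtx a) (vtx b) (trans (length-bin L _) (sym (length-bin L _))) eq
    = bin-toℕ-injective L (n≤2^⌈log₂n⌉ n) a b vtx≡ , w≡

  revClr-peel : ∀ {a b c d w w′} → revClr a b ++ w ≡ revClr c d ++ w′ → col a b ≡ col c d × w ≡ w′
  revClr-peel {a} {b} {c} {d} eq
    with clr≡ , w≡ ← reverse-++-injective (clr a b) (clr c d)
                       (trans (length-bin (2 * L) _) (sym (length-bin (2 * L) _))) eq
    = bin-toℕ-injective (2 * L) n*n≤2^[2*L] (col a b) (col c d) clr≡ , w≡

  revClr-cong : ∀ {a b c d} → col a b ≡ col c d → revClr a b ≡ revClr c d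
  revClr-cong = cong (λ c → reverse (bin (2 * L) (toℕ c)))

  Run-k1 : ∀ a b → Run (ops k1 a b) [] (revClr a b ++ revVtx b ++ revVtx a)
  Run-k1 a b = subst (Run (ops k1 a b) []) (cong (λ s → revClr a b ++ revVtx b ++ s) (++-identityʳ (revVtx a)))
                 (Run-++ (Run-pushW (vtx a)) (Run-++ (Run-pushW (vtx b)) (Run-pushW (clr a b))))

  Run-k2 : ∀ a b {w} → Run (ops k2 a b) (revClr a b ++ w) (revClr a b ++ w)
  Run-k2 a b = Run-++ (Run-pops (revClr a b)) (Run-pushW (clr a b))

  Run-k3 : ∀ a b {w} → Run (ops k3 a b) (revClr a b ++ w) w
  Run-k3 a b = Run-pops (revClr a b)

  Run-k4 : ∀ a b → Run (ops k4 a b) (revVtx b ++ revVtx a) []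
  Run-k4 a b = Run-++ (Run-pops (revVtx b))
                      (subst (λ s → Run (popW (vtx a)) s []) (++-identityʳ (revVtx a)) (Run-pops (revVtx a)))

  triangle⇒reach : ∀ {i j} → Edge i j → MonoTriangle i j → Reach 𝒫 (x i , []) (y' j , [])
  triangle⇒reach {i} {j} eij (k , ejk , eki , c₁ , c₂) =
    Run⇒Reach-macroT k1 eij (Run-k1 i j) ◅◅
    Run⇒Reach-macroT k2 ejk run-jk ◅◅
    Run⇒Reach-macroT k3 eki run-ki ◅◅
    Run⇒Reach-macroT k4 eij (Run-k4 i j)
    where
    R : List Bool
    R = revVtx j ++ revVtx i
    run-jk : Run (ops k2 j k) (revClr i j ++ R) (revClr j k ++ R)
    run-jk = subst (λ s → Run (ops k2 j k) (s ++ R) (revClr j k ++ R)) (revClr-cong (sym c₁)) (Run-k2 j k)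
    run-ki : Run (ops k3 k i) (revClr j k ++ R) R
    run-ki = subst (λ s → Run (ops k3 k i) (s ++ R) R) (revClr-cong (sym c₂)) (Run-k3 k i)

  MacroClosed : (State n → List Bool → Set) → Set
  MacroClosed I = ∀ κ {a b w w′} → Edge a b → I (source κ a) w → Run (ops κ a b) w w′ →
                  I (target κ b) w′

  module MacroInvariant (I : State n → List Bool → Set) (closed : MacroClosed I) where

    Lift : Config 𝒫 → Set
    Lift (aux κ a b m , w) = ∃₂ λ pre post → ops κ a b ≡ pre ++ post × length pre ≡ suc m ×
                               ∃ λ w₀ → I (source κ a) w₀ × Run pre w₀ w
    Lift (q , w) = I q w

    Lift-source : ∀ κ {a w} → Lift (source κ a , w) → I (source κ a) w
    Lift-source k1 l = l
    Lift-source k2 l = l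
    Lift-source k3 l = l
    Lift-source k4 l = l

    Lift-target : ∀ κ {b w} → I (target κ b) w → Lift (target κ b , w)
    Lift-target k1 i = i
    Lift-target k2 i = i
    Lift-target k3 i = i
    Lift-target k4 i = i

    module _ (κ : Kind) (a b : Fin n) where

      at : ℕ → List Op → State n
      at = stateAt (source κ a) (aux κ a b) (target κ b)

      started : ∀ pre {o post w} → ops κ a b ≡ pre ++ o ∷ post → Lift (at (length pre) (o ∷ post) , w) →
                ∃ λ w₀ → I (source κ a) w₀ × Run pre w₀ w
      started []        _  l = _ , Lift-source κ l , []
      started (o ∷ pre) eq (pre₂ , _ , eq₂ , len₂ , w₀ , i₀ , r)
        with refl , _ ← ++-injective pre₂ (o ∷ pre) len₂ (trans (sym eq₂) eq) = w₀ , i₀ , r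

      continued : ∀ {done post k w₀ w} → Edge a b → ops κ a b ≡ done ++ post → length done ≡ suc k →
                  I (source κ a) w₀ → Run done w₀ w → Lift (at (suc k) post , w)
      continued {done} {[]}    e eq _   i₀ r =
        Lift-target κ (closed κ e i₀ (subst (λ os → Run os _ _) (sym (trans eq (++-identityʳ done))) r))
      continued {done} {_ ∷ _} e eq len i₀ r = done , _ , eq , len , _ , i₀ , r

      advance : ∀ pre {o post w w′} → Edge a b → ops κ a b ≡ pre ++ o ∷ post →
                Lift (at (length pre) (o ∷ post) , w) → Exec o w w′ → Lift (at (suc (length pre)) post , w′)
      advance pre {o} {post} e eq l step with w₀ , i₀ , r ← started pre eq l =
        continued e (trans eq (sym (++-assoc pre [ o ] post))) (trans (length-++ pre) (+-comm _ 1)) i₀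
          (Run-++ r (step ∷ []))

    Step-preserves : ∀ {c c′} → Step 𝒫 c c′ → Lift c → Lift c′
    Step-preserves (stepε (mac {i = a} {j = b} κ e m)) l with ∈-chain⁻ (subst (_ ∈_) (macroT≡chain κ a b) m)
    ... | inj₁ (eq , refl) =
      Lift-target κ (closed κ e (Lift-source κ l) (subst (λ os → Run os _ _) (sym eq) []))
    ... | inj₂ (pre , push _ , _ , eq , refl) = advance κ a b pre e eq l push
    Step-preserves (stepPop (mac {i = a} {j = b} κ e m)) l with ∈-chain⁻ (subst (_ ∈_) (macroT≡chain κ a b) m)
    ... | inj₂ (pre , pop _ , _ , eq , refl) = advance κ a b pre e eq l pop

    Reach-preserves : ∀ {c c′} → Reach 𝒫 c c′ → Lift c → Lift c′
    Reach-preserves ε       l = l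
    Reach-preserves (s ◅ p) l = Reach-preserves p (Step-preserves s l)

  module PathsFrom (i : Fin n) where

    Invariant : State n → List Bool → Set
    Invariant (x a)  w = a ≡ i × w ≡ []
    Invariant (y b)  w = w ≡ revClr i b ++ revVtx b ++ revVtx i
    Invariant (z k)  w = ∃ λ b → Edge b k × col i b ≡ col b k × w ≡ revClr b k ++ revVtx b ++ revVtx i
    Invariant (x' l) w = ∃₂ λ b k → Edge b k × Edge k l × col i b ≡ col b k × col b k ≡ col k l ×
                           w ≡ revVtx b ++ revVtx i
    Invariant (y' m) w = MonoTriangle i m
    Invariant (aux _ _ _ _) w = ⊥

    Invariant-closed : MacroClosed Invariant
    Invariant-closed k1 {a} {b} _ (refl , refl) r = Run-deterministic r (Run-k1 a b)
    Invariant-closed k2 {a} {b} e refl r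
      with u , r-pop , r-push ← Run-++⁻ (popW (clr a b)) r
      with col≡ , refl ← revClr-peel (Run-pops⁻ (revClr a b) r-pop)
      = a , e , col≡ , Run-deterministic r-push (Run-pushW (clr a b))
    Invariant-closed k3 {a} {b} e (c , eca , cc , refl) r
      with col≡ , refl ← revClr-peel (Run-pops⁻ (revClr a b) r)
      = c , a , eca , e , cc , col≡ , refl
    Invariant-closed k4 {a} {b} _ (c , k , eck , eka , c₁ , c₂ , refl) r
      with u , r-popb , r-popa ← Run-++⁻ (popW (vtx b)) r
      with refl , refl ← revVtx-peel (Run-pops⁻ (revVtx b) r-popb)
      with refl , refl ← revVtx-peel (trans (++-identityʳ (revVtx i)) (Run-pops⁻ (revVtx a) r-popa))
      = k , eck , eka , c₁ , c₂

    open MacroInvariant Invariant Invariant-closed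

    reach⇒triangle : ∀ {j} → Reach 𝒫 (x i , []) (y' j , []) → MonoTriangle i j
    reach⇒triangle path = Reach-preserves path (refl , refl)

lemma4 : (n : ℕ) (G : ColouredGraph n) (i j : Fin n) →
         ColouredGraph.Edge G i j →
         ColouredGraph.MonoTriangle G i j
           ⇔ Reach (Construction.𝒫 G) (x i , []) (y' j , [])
lemma4 n G i j eij = mk⇔ (triangle⇒reach eij) reach⇒triangle
  where
  open Reduction G
  open PathsFrom i
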